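{- Let $H$ be a hypergraph and let $F$ be a reduced elimination forest of $H$. Then for each $u\in V(H)$, the induced subhypergraph $H[V(F_u)]$ is connected. Moreover, for each non-leaf vertex $u$ and each child $v$ of $u$ in $F$, $H[V(F_v)\cup\{u\}]$ is connected.
   Context: A hypergraph $H$ has finite vertex set $V(H)$ and edges that are non-empty subsets of $V(H)$. Two vertices are adjacent if some edge contains both; for $U\subseteq V(H)$, $H[U]$ has vertex set $U$ and edges $\{e\cap U: e\cap U\neq\emptyset\}$, and it is connected if its vertices are connected via chains of adjacent vertices. An elimination forest $F$ of $H$ is a rooted forest on $V(H)$ such that any two vertices of a common edge are in ancestor–descendant relation. $F_u$ denotes the subtree of descendants of $u$ (including $u$). $F$ is reduced if for each non-leaf vertex $u$ and each child $v$ of $u$, $u$ is adjacent in $H$ to some vertex of $V(F_v)$. -}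

module Defs where

open import Data.Nat using (ℕ)
open import Data.Fin using (Fin)
open import Data.List using (List; [])
open import Data.List.Membership.Propositional using (_∈_)
open import Data.List.Relation.Unary.All using (All)
open import Data.Maybe using (Maybe; just)
open import Data.Product using (Σ; ∃; _×_)
open import Data.Sum using (_⊎_)
open import Relation.Binary.PropositionalEquality using (_≡_; _≢_)
open import Relation.Binary.Construct.Closure.ReflexiveTransitive using (Star)
open import Relation.Nullary using (¬_)

-- A hypergraph on vertex set Fin n: a list of edges, each a non-empty
-- list of vertices (read as the subset of its elements).
record Hypergraph (n : ℕ) : Set where
  field
    edges    : List (List (Fin n))
    nonEmpty : All (λ e → e ≢ []) edges
open Hypergraph public

Adjacent : ∀ {n} → Hypergraph n → Fin n → Fin n → Set
Adjacent H x y = Σ (List _) λ e → e ∈ edges H × x ∈ e × y ∈ e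

AdjacentIn : ∀ {n} → Hypergraph n → (Fin n → Set) → Fin n → Fin n → Set
AdjacentIn H U x y = U x × U y × Adjacent H x y

ConnectedInduced : ∀ {n} → Hypergraph n → (Fin n → Set) → Set
ConnectedInduced H U = ∀ x y → U x → U y → Star (AdjacentIn H U) x y

-- A rooted forest on Fin n, given by a parent map (nothing = root).
-- Ancestor p u v : u is an ancestor of v (u = v allowed).
data Ancestor {n} (parent : Fin n → Maybe (Fin n)) (u : Fin n) : Fin n → Set where
  here  : Ancestor parent u u
  there : ∀ {v w} → parent v ≡ just w → Ancestor parent u w → Ancestor parent u v

record Forest (n : ℕ) : Set where
  field
    parent  : Fin n → Maybe (Fin n)
    acyclic : ∀ v w → parent v ≡ just w → ¬ Ancestor parent v w
open Forest public

_≼[_]_ : ∀ {n} → Fin n → Forest n → Fin n → Set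
u ≼[ F ] v = Ancestor (parent F) u v

Child : ∀ {n} → Forest n → Fin n → Fin n → Set
Child F u v = parent F v ≡ just u

Subtree : ∀ {n} → Forest n → Fin n → Fin n → Set
Subtree F u x = u ≼[ F ] x

IsEliminationForest : ∀ {n} → Hypergraph n → Forest n → Set
IsEliminationForest H F =
  ∀ e → e ∈ edges H → ∀ x y → x ∈ e → y ∈ e → (x ≼[ F ] y) ⊎ (y ≼[ F ] x)

IsReduced : ∀ {n} → Hypergraph n → Forest n → Set
IsReduced H F = ∀ u v → Child F u v → ∃ λ w → Subtree F v w × Adjacent H u w

module Submission where

open import Defs
open import Data.Nat using (ℕ; zero; suc; s<s)
open import Data.Nat.Properties using (n<1+n)
open import Data.Fin using (Fin; zero; suc; _<_)
open import Data.Fin.Properties using (pigeonhole)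
open import Data.Product using (∃; _×_; _,_)
open import Data.Sum using (_⊎_; inj₁; inj₂)
open import Function using (flip)
open import Induction.WellFounded using (WellFounded; Acc; acc)
open import Relation.Nullary using (¬_; contradiction)
open import Relation.Binary.PropositionalEquality using (_≡_; _≢_; refl; sym; subst)
open import Relation.Binary.Construct.Closure.ReflexiveTransitive using (Star; ε; _◅_; _◅◅_; map; reverse)

-- A reduced forest lets every vertex of F_v reach v inside H[F_v]: x lies in
-- some child subtree F_c, reaches c there by induction, c reaches the vertex w
-- of F_c adjacent to v, and w steps to v. The induction is well-founded
-- because a finite acyclic forest has no descending path through n + 1
-- vertices (pigeonhole). Both claims then follow by routing every pair of
-- vertices through a common hub: v, which u also reaches through w.

module _ {n : ℕ} (F : Forest n) where

  ≼-trans : ∀ {a b c} → a ≼[ F ] b → b ≼[ F ] c → a ≼[ F ] c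
  ≼-trans p here        = p
  ≼-trans p (there q r) = there q (≼-trans p r)

  child⇒≼ : ∀ {u v} → Child F u v → u ≼[ F ] v
  child⇒≼ p = there p here

  ≼⇒≡⊎child≼ : ∀ {v x} → v ≼[ F ] x → x ≡ v ⊎ ∃ λ c → Child F v c × c ≼[ F ] x
  ≼⇒≡⊎child≼ here = inj₁ refl
  ≼⇒≡⊎child≼ (there p a) with ≼⇒≡⊎child≼ a
  ... | inj₁ refl          = inj₂ (_ , p , here)
  ... | inj₂ (c , vc , ca) = inj₂ (c , vc , there p ca)

  -- Length k means k + 1 vertices v = v₀, v₁, …, v_k.
  data Descent : ℕ → Fin n → Set where
    []  : ∀ {v} → Descent zero v
    _∷_ : ∀ {k v c} → Child F v c → Descent k c → Descent (suc k) v

  vertex : ∀ {k v} → Descent k v → Fin (suc k) → Fin n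
  vertex {v = v} d       zero    = v
  vertex         (_ ∷ d) (suc i) = vertex d i

  ≼-vertex : ∀ {k v} (d : Descent k v) i → v ≼[ F ] vertex d i
  ≼-vertex d       zero    = here
  ≼-vertex (p ∷ d) (suc i) = ≼-trans (child⇒≼ p) (≼-vertex d i)

  vertex-distinct : ∀ {k v} (d : Descent k v) {i j} → i < j → vertex d i ≢ vertex d j
  vertex-distinct (p ∷ d) {zero}  {suc j} _         eq =
    acyclic F _ _ p (subst (_ ≼[ F ]_) (sym eq) (≼-vertex d j))
  vertex-distinct (p ∷ d) {suc i} {suc j} (s<s i<j) eq = vertex-distinct d i<j eq

  no-Descent-of-length-n : ∀ {v} → ¬ Descent n v
  no-Descent-of-length-n d with pigeonhole (n<1+n n) (vertex d)
  ... | i , j , i<j , eq = vertex-distinct d i<j eq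

  acc-if-no-Descent : ∀ k v → ¬ Descent k v → Acc (flip (Child F)) v
  acc-if-no-Descent zero    v no-d = contradiction [] no-d
  acc-if-no-Descent (suc k) v no-d = acc λ vc → acc-if-no-Descent k _ (λ d → no-d (vc ∷ d))

  child-wellFounded : WellFounded (flip (Child F))
  child-wellFounded v = acc-if-no-Descent n v no-Descent-of-length-n

module _ {n : ℕ} (H : Hypergraph n) where

  Adjacent-sym : ∀ {x y} → Adjacent H x y → Adjacent H y x
  Adjacent-sym (e , e∈H , x∈e , y∈e) = e , e∈H , y∈e , x∈e

  AdjacentIn-sym : ∀ {U x y} → AdjacentIn H U x y → AdjacentIn H U y x
  AdjacentIn-sym (ux , uy , adj) = uy , ux , Adjacent-sym adj

  AdjacentIn-mono : ∀ {U V : Fin n → Set} → (∀ {z} → U z → V z) →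
                    ∀ {x y} → AdjacentIn H U x y → AdjacentIn H V x y
  AdjacentIn-mono U⊆V (ux , uy , adj) = U⊆V ux , U⊆V uy , adj

  connected-via-hub : ∀ {U} h → (∀ x → U x → Star (AdjacentIn H U) x h) →
                      ConnectedInduced H U
  connected-via-hub h reach x y ux uy = reach x ux ◅◅ reverse AdjacentIn-sym (reach y uy)

  module _ (F : Forest n) (reduced : IsReduced H F) where

    reaches-root : ∀ v → Acc (flip (Child F)) v →
                   ∀ x → Subtree F v x → Star (AdjacentIn H (Subtree F v)) x v
    reaches-root v (acc rec) x vx with ≼⇒≡⊎child≼ F vx
    ... | inj₁ refl = ε
    ... | inj₂ (c , vc , cx) with reduced v c vc
    ...   | w , cw , v~w =
      lift (reaches-root c (rec vc) x cx)
      ◅◅ lift (reverse AdjacentIn-sym (reaches-root c (rec vc) w cw))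
      ◅◅ (into-F_v cw , here , Adjacent-sym v~w) ◅ ε
      where
        into-F_v : ∀ {z} → Subtree F c z → Subtree F v z
        into-F_v = ≼-trans F (child⇒≼ F vc)
        lift : ∀ {x y} → Star (AdjacentIn H (Subtree F c)) x y → Star (AdjacentIn H (Subtree F v)) x y
        lift = map (AdjacentIn-mono into-F_v)

    subtree-connected : ∀ v → ConnectedInduced H (Subtree F v)
    subtree-connected v = connected-via-hub v (reaches-root v (child-wellFounded F v))

    child-subtree-with-parent-connected : ∀ u v → Child F u v →
      ConnectedInduced H (λ x → Subtree F v x ⊎ x ≡ u)
    child-subtree-with-parent-connected u v uv = connected-via-hub v reach
      where
        reach-in-F_v : ∀ x → Subtree F v x → Star (AdjacentIn H (λ x → Subtree F v x ⊎ x ≡ u)) x v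
        reach-in-F_v x vx = map (AdjacentIn-mono inj₁) (reaches-root v (child-wellFounded F v) x vx)

        reach : ∀ x → Subtree F v x ⊎ x ≡ u → Star (AdjacentIn H (λ x → Subtree F v x ⊎ x ≡ u)) x v
        reach x (inj₁ vx)   = reach-in-F_v x vx
        reach x (inj₂ refl) with reduced u v uv
        ... | w , vw , u~w = (inj₂ refl , inj₁ vw , u~w) ◅ reach-in-F_v w vw

lemma17 : ∀ {n} (H : Hypergraph n) (F : Forest n) →
    IsEliminationForest H F → IsReduced H F →
    (∀ u → ConnectedInduced H (Subtree F u)) ×
    (∀ u v → Child F u v → ConnectedInduced H (λ x → Subtree F v x ⊎ x ≡ u))
lemma17 H F _ reduced =
  subtree-connected H F reduced , child-subtree-with-parent-connected H F reduced
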